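{- For every context $\Gamma$ and proposition $\varphi$ of the system $\mathcal{E}_0$: (1) if $\Gamma\vdash_{\mathcal{E}_0}\varphi\ \mathit{true}$ then $\ell(\Gamma)\vdash_L \ell(\varphi)\ \mathit{true}$; (2) if $\Gamma\vdash_{\mathcal{E}_0}\varphi\ \mathit{just\ true}$ then $\ell(\Gamma)\vdash_L \ell(\varphi)\ \mathit{lax}$.
   Context: The system $\mathcal{E}_0$: propositions are generated by $\varphi ::= p \mid \varphi\to\psi \mid \mathsf{E}\varphi$ ($p$ atomic, $\mathsf{E}$ a unary modality); contexts $\Gamma$ are finite lists $\varphi_1\ \mathit{true},\dots,\varphi_n\ \mathit{true}$; judgments $\Gamma\vdash_{\mathcal{E}_0}\varphi\ \mathit{true}$ and $\Gamma\vdash_{\mathcal{E}_0}\varphi\ \mathit{just\ true}$ are defined inductively by exactly the rules: (HYP) $\Gamma,\varphi\ \mathit{true}\vdash\varphi\ \mathit{true}$; (JUST) from $\Gamma\vdash\varphi\ \mathit{true}$ infer $\Gamma\vdash\varphi\ \mathit{just\ true}$; ($\to$I) from $\Gamma,\varphi\ \mathit{true}\vdash\psi\ \mathit{true}$ infer $\Gamma\vdash\varphi\to\psi\ \mathit{true}$; ($\to$E) from $\Gamma\vdash\varphi\to\psi\ \mathit{true}$ and $\Gamma\vdash\varphi\ \mathit{true}$ infer $\Gamma\vdash\psi\ \mathit{true}$; ($\mathsf{E}$I) from $\Gamma\vdash\varphi\ \mathit{just\ true}$ infer $\Gamma\vdash\mathsf{E}\varphi\ \mathit{true}$; ($\mathsf{E}$E)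 from $\Gamma\vdash\mathsf{E}\varphi\ \mathit{true}$ and $\Gamma,\varphi\ \mathit{true}\vdash\gamma\ \mathit{just\ true}$ infer $\Gamma\vdash\gamma\ \mathit{just\ true}$. (This is the fragment of the paper's logic of judgmental existence without the "just true" variants of the implication and modality rules.) Pfenning–Davies lax logic $L$: propositions $A ::= p \mid A\supset B \mid \bigcirc A$; contexts are finite lists of hypotheses $A\ \mathit{true}$; judgments $\Gamma\vdash_L A\ \mathit{true}$ and $\Gamma\vdash_L A\ \mathit{lax}$ are defined inductively by: (hyp) $\Gamma_1,A\ \mathit{true},\Gamma_2\vdash A\ \mathit{true}$; ($\supset$I) from $\Gamma,A\ \mathit{true}\vdash B\ \mathit{true}$ infer $\Gamma\vdash A\supset B\ \mathit{true}$; ($\supset$E) from $\Gamma\vdash A\supset B\ \mathit{true}$ and $\Gamma\vdash A\ \mathit{true}$ infer $\Gamma\vdash B\ \mathit{true}$; (lax) from $\Gamma\vdash A\ \mathit{true}$ infer $\Gamma\vdash A\ \mathit{lax}$; ($\bigcirc$I) from $\Gamma\vdash A\ \mathit{lax}$ infer $\Gamma\vdash\bigcirc A\ \mathit{true}$; ($\bigcirc$E) from $\Gamma\vdash\bigcirc A\ \mathit{true}$ and $\Gamma,A\ \mathit{true}\vdash C\ \mathit{lax}$ infer $\Gamma\vdash C\ \mathit{lax}$. Translation $\ell$: $\ell(p)=p$, $\ell(\varphi\to\psi)=\ell(\varphi)\supset\ell(\psi)$, $\ell(\mathsf{E}\varphi)=\bigcirc\ell(\varphi)$, and on contexts $\ell(\cdot)=\cdot$,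 $\ell(\Gamma,\varphi\ \mathit{true})=\ell(\Gamma),\ell(\varphi)\ \mathit{true}$. -}

module Defs where

open import Data.Nat using (ℕ)

data Prop₀ : Set where
  atom : ℕ → Prop₀
  _⇒_  : Prop₀ → Prop₀ → Prop₀
  E    : Prop₀ → Prop₀

data Ctx₀ : Set where
  ·   : Ctx₀
  _,_ : Ctx₀ → Prop₀ → Ctx₀

infixl 5 _,_
infixr 6 _⇒_

mutual
  data _⊢E_true : Ctx₀ → Prop₀ → Set where
    HYP : ∀ {Γ φ} → (Γ , φ) ⊢E φ true
    →I  : ∀ {Γ φ ψ} → (Γ , φ) ⊢E ψ true → Γ ⊢E (φ ⇒ ψ) true
    →E  : ∀ {Γ φ ψ} → Γ ⊢E (φ ⇒ ψ) true → Γ ⊢E φ true → Γ ⊢E ψ true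
    EI  : ∀ {Γ φ} → Γ ⊢E φ justTrue → Γ ⊢E E φ true

  data _⊢E_justTrue : Ctx₀ → Prop₀ → Set where
    JUST : ∀ {Γ φ} → Γ ⊢E φ true → Γ ⊢E φ justTrue
    EE   : ∀ {Γ φ γ} → Γ ⊢E E φ true → (Γ , φ) ⊢E γ justTrue → Γ ⊢E γ justTrue

-- Pfenning–Davies lax logic L

data PropL : Set where
  atom : ℕ → PropL
  _⊃_  : PropL → PropL → PropL
  ◯    : PropL → PropL

infixr 6 _⊃_

data CtxL : Set where
  ·   : CtxL
  _,_ : CtxL → PropL → CtxL

_++_ : CtxL → CtxL → CtxL
Γ ++ · = Γ
Γ ++ (Δ , A) = (Γ ++ Δ) , A

infixl 4 _++_

mutual
  data _⊢L_true : CtxL → PropL → Set where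
    hyp : ∀ {Γ₁ A Γ₂} → ((Γ₁ , A) ++ Γ₂) ⊢L A true
    ⊃I  : ∀ {Γ A B} → (Γ , A) ⊢L B true → Γ ⊢L (A ⊃ B) true
    ⊃E  : ∀ {Γ A B} → Γ ⊢L (A ⊃ B) true → Γ ⊢L A true → Γ ⊢L B true
    ◯I  : ∀ {Γ A} → Γ ⊢L A lax → Γ ⊢L ◯ A true

  data _⊢L_lax : CtxL → PropL → Set where
    lax : ∀ {Γ A} → Γ ⊢L A true → Γ ⊢L A lax
    ◯E  : ∀ {Γ A C} → Γ ⊢L ◯ A true → (Γ , A) ⊢L C lax → Γ ⊢L C lax

ℓ : Prop₀ → PropL
ℓ (atom p) = atom p
ℓ (φ ⇒ ψ) = ℓ φ ⊃ ℓ ψ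
ℓ (E φ) = ◯ (ℓ φ)

ℓᶜ : Ctx₀ → CtxL
ℓᶜ · = ·
ℓᶜ (Γ , φ) = ℓᶜ Γ , ℓ φ

{-# OPTIONS --safe #-}
module Submission where

open import Defs
open import Data.Product using (_×_) renaming (_,_ to _,ₚ_)

hyp-last : ∀ {Γ A} → (Γ , A) ⊢L A true
hyp-last = hyp {Γ₂ = ·}

mutual
  ℓ-true : ∀ {Γ φ} → Γ ⊢E φ true → ℓᶜ Γ ⊢L ℓ φ true
  ℓ-true HYP       = hyp-last
  ℓ-true (→I d)    = ⊃I (ℓ-true d)
  ℓ-true (→E d e)  = ⊃E (ℓ-true d) (ℓ-true e)
  ℓ-true (EI d)    = ◯I (ℓ-justTrue d)

  ℓ-justTrue : ∀ {Γ φ} → Γ ⊢E φ justTrue → ℓᶜ Γ ⊢L ℓ φ lax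
  ℓ-justTrue (JUST d) = lax (ℓ-true d)
  ℓ-justTrue (EE d e) = ◯E (ℓ-true d) (ℓ-justTrue e)

proposition8 : (Γ : Ctx₀) (φ : Prop₀) →
    (Γ ⊢E φ true → ℓᶜ Γ ⊢L ℓ φ true) × (Γ ⊢E φ justTrue → ℓᶜ Γ ⊢L ℓ φ lax)
proposition8 Γ φ = ℓ-true ,ₚ ℓ-justTrue
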